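{- Let $G$ be a graph with $n$ vertices and rooted spanning tree $T$ with root $r$, and let $G^{\ast}=G-E_T$. Let $\vec{T}$, the Euler tour $e_1,\dots,e_{2n-2}$, the coordinates $c(\cdot)$, the points $p(e)$ and the halfspaces $\mathit{hs}(z,a)$ be as defined below. Then for every vertex subset $S\subseteq V_G$ and every edge subset $E'\subseteq E_{G^{\ast}}$, $$\partial_{E'}(S)=\Big\{e\in E' : p(e)\in \triangle_{e''\in\partial_{\vec{T}}(S),\,z\in\{x,y\}}\ \mathit{hs}(z,c(e''))\Big\},$$ where $\triangle$ denotes the symmetric difference of sets.
   Context: $\partial_X(S)$ is the set of edges of $X$ with exactly one endpoint in $S$. $\vec{T}$ is obtained from $T$ by replacing each edge by two directed edges of opposite orientation; $\partial_{\vec{T}}(S)$ is the set of directed edges arising from edges of $\partial_T(S)$. Fix an Euler tour $e_1,e_2,\dots,e_{2n-2}$ of $\vec{T}$ starting at $r$, and set $c(e_i)=i$ for directed edges. For a vertex $v\neq r$, $c(v)$ is the index of the directed edge from the parent of $v$ into $v$; $c(r)=0$. A non-tree edge $e=(u,v)$ is mapped to the planar point $p(e)=(\min(c(u),c(v)),\max(c(u),c(v)))$. For $a$ an integer and $z\in\{x,y\}$, $\mathit{hs}(z,a)$ is the set of points of the plane whose $z$-coordinate is at least $a$. -}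

module Defs where

open import Data.Nat using (ℕ; zero; suc; _≤_)
open import Data.Fin using (Fin)
open import Data.Fin.Properties using () renaming (_≟_ to _≟ᶠ_)
open import Data.Fin.Subset using (Subset)
open import Data.Bool using (Bool; true; false; _xor_; if_then_else_)
open import Data.Vec using (lookup)
open import Data.Product using (Σ; ∃; _×_; _,_; proj₁; proj₂)
open import Data.Product.Properties using (≡-dec)
open import Data.Sum using (_⊎_)
open import Data.Empty using (⊥)
open import Data.Unit using (⊤)
open import Data.List using (List; []; _∷_; filter; concatMap; allFin)
open import Data.List.Membership.Propositional using (_∈_)
open import Data.List.Relation.Unary.All using (All)
open import Data.List.Relation.Unary.Unique.Propositional using (Unique)
open import Relation.Nullary using (¬_; yes; no)
open import Relation.Binary.PropositionalEquality using (_≡_; _≢_)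

record Graph (n : ℕ) : Set₁ where
  field
    Adj     : Fin n → Fin n → Set
    Adj-sym : ∀ {u v} → Adj u v → Adj v u
    Adj-irr : ∀ {u} → ¬ Adj u u
open Graph public

-- an (undirected) edge {u,v} is represented by an ordered pair (u , v);
-- edge sets are predicates on such pairs
Pair : ℕ → Set
Pair n = Fin n × Fin n

iter : ∀ {A : Set} → (A → A) → ℕ → A → A
iter f zero    x = x
iter f (suc k) x = f (iter f k x)

-- A spanning tree T of G rooted at r, given by its parent function:
-- every v ≠ r is joined in G to its parent, parent r = r, and iterating
-- the parent function from any vertex reaches the root (no cycles).
record RootedSpanningTree {n : ℕ} (G : Graph n) (r : Fin n) : Set where
  field
    parent      : Fin n → Fin n
    parent-root : parent r ≡ r
    parent-adj  : ∀ v → v ≢ r → Adj G (parent v) v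
    reaches     : ∀ v → ∃ λ k → iter parent k v ≡ r
open RootedSpanningTree public

module _ {n : ℕ} {G : Graph n} {r : Fin n} (T : RootedSpanningTree G r) where

  TreeEdge : Pair n → Set
  TreeEdge (u , v) = (u ≢ r × v ≡ parent T u) ⊎ (v ≢ r × u ≡ parent T v)

  IsArc : Pair n → Set
  IsArc (u , v) = (v ≢ r × u ≡ parent T v) ⊎ (u ≢ r × v ≡ parent T u)

  treeArcs : List (Pair n)
  treeArcs = concatMap arcsAt (allFin n)
    where
    arcsAt : Fin n → List (Pair n)
    arcsAt v with v ≟ᶠ r
    ... | yes _ = []
    ... | no  _ = (parent T v , v) ∷ (v , parent T v) ∷ []

Chain : ∀ {n} → Fin n → List (Pair n) → Fin n → Set
Chain a []             b = a ≡ b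
Chain a ((u , v) ∷ es) b = a ≡ u × Chain v es b

record IsEulerTour {n : ℕ} {G : Graph n} {r : Fin n}
                   (T : RootedSpanningTree G r) (tour : List (Pair n)) : Set where
  field
    closed   : Chain r tour r
    onlyArcs : All (IsArc T) tour
    noRepeat : Unique tour
    allArcs  : ∀ a → IsArc T a → a ∈ tour
open IsEulerTour public

_≟ₚ_ : ∀ {n} (a b : Pair n) → Relation.Nullary.Dec (a ≡ b)
_≟ₚ_ = ≡-dec _≟ᶠ_ _≟ᶠ_

-- 1-based position of an arc in the tour: c(e_i) = i
pos : ∀ {n} → Pair n → List (Pair n) → ℕ
pos a []       = 0
pos a (b ∷ bs) with a ≟ₚ b
... | yes _ = 1
... | no  _ = suc (pos a bs)

module Coords {n : ℕ} {G : Graph n} {r : Fin n}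
              (T : RootedSpanningTree G r) (tour : List (Pair n)) where

  cArc : Pair n → ℕ
  cArc a = pos a tour

  cV : Fin n → ℕ
  cV v with v ≟ᶠ r
  ... | yes _ = 0
  ... | no  _ = cArc (parent T v , v)

  p : Pair n → ℕ × ℕ
  p (u , v) = Data.Nat._⊓_ (cV u) (cV v) , Data.Nat._⊔_ (cV u) (cV v)

PointSet : Set₁
PointSet = ℕ × ℕ → Set

data Coord : Set where
  x y : Coord

hs : Coord → ℕ → PointSet
hs x a q = a ≤ proj₁ q
hs y a q = a ≤ proj₂ q

_△_ : PointSet → PointSet → PointSet
(A △ B) q = (A q × ¬ B q) ⊎ (¬ A q × B q)

∅ : PointSet
∅ _ = ⊥

△-family : List PointSet → PointSet
△-family []       = ∅
△-family (A ∷ As) = A △ △-family As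

crosses : ∀ {n} → Subset n → Pair n → Bool
crosses S (u , v) = lookup S u xor lookup S v

∂T⃗ : ∀ {n} {G : Graph n} {r : Fin n} → RootedSpanningTree G r → Subset n → List (Pair n)
∂T⃗ T S = filter (λ a → crosses S a Data.Bool.≟ true) (treeArcs T)

boundarySymDiff : ∀ {n} {G : Graph n} {r : Fin n} → RootedSpanningTree G r
                → List (Pair n) → Subset n → PointSet
boundarySymDiff T tour S =
  △-family (concatMap (λ e → hs x (Coords.cArc T tour e) ∷ hs y (Coords.cArc T tour e) ∷ [])
                      (∂T⃗ T S))

∂E : ∀ {n} → (Pair n → Set) → Subset n → Pair n → Set
∂E E' S e = E' e × crosses S e ≡ true

-- A point q = (q₁ , q₂) lies in the symmetric difference iff an odd number of
-- pairs (e'', z) have c(e'') ≤ q_z, i.e. iff X(q₁) ≠ X(q₂), where X(k) is the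
-- parity of the number of boundary arcs among the first k arcs of the tour.
-- Those k arcs form a walk from r, which crosses ∂(S) an odd number of times
-- iff it ends on the other side of S from r.  The first c(v) arcs end at v, so
-- X(c(u)) xor X(c(v)) = [r ∈ S] xor [u ∈ S] xor [r ∈ S] xor [v ∈ S], which says
-- exactly that (u , v) crosses S.
module Submission where

open import Defs
open import Algebra.Bundles using (CommutativeRing; CommutativeMonoid)
open import Data.Bool using (Bool; true; false; _xor_; _∧_; _≟_)
open import Data.Bool.Properties
  using (xor-∧-commutativeRing; xor-assoc; xor-comm; xor-same; ∧-distribˡ-xor; ∧-zeroʳ; ∧-identityʳ)
open import Data.Empty using (⊥; ⊥-elim)
open import Data.Fin using (Fin)
open import Data.Fin.Properties using () renaming (_≟_ to _≟ᶠ_)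
open import Data.Fin.Subset using (Subset)
open import Data.List using (List; []; _∷_; [_]; _++_; filter; concatMap; allFin; take)
open import Data.List.Membership.Propositional using (_∈_; lose)
open import Data.List.Membership.Propositional.Properties using (∈-concatMap⁺; ∈-concatMap⁻; ∈-allFin)
open import Data.List.Membership.Propositional.Properties.WithK using (unique∧set⇒bag)
open import Data.List.Properties using (concatMap-cong)
open import Data.List.Relation.Binary.BagAndSetEquality using (∼bag⇒↭)
open import Data.List.Relation.Binary.Disjoint.Propositional using (Disjoint)
open import Data.List.Relation.Binary.Permutation.Propositional
  using (_↭_; prep; swap; ↭-sym) renaming (refl to ↭-refl; trans to ↭-trans)
open import Data.List.Relation.Binary.Permutation.Propositional.Properties using (filter-↭)
open import Data.List.Relation.Unary.All as All using ([]; _∷_)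
open import Data.List.Relation.Unary.All.Properties using () renaming (map⁺ to All-map⁺)
open import Data.List.Relation.Unary.AllPairs as AllPairs using ([]; _∷_)
open import Data.List.Relation.Unary.AllPairs.Properties using () renaming (map⁺ to AllPairs-map⁺)
open import Data.List.Relation.Unary.Any using (here; there; satisfied)
open import Data.List.Relation.Unary.Unique.Propositional using (Unique)
open import Data.List.Relation.Unary.Unique.Propositional.Properties using (concat⁺; allFin⁺)
open import Data.Nat using (ℕ; zero; suc; _⊓_; _⊔_; _≤ᵇ_)
open import Data.Nat.Properties
  using (≤ᵇ-reflects-≤; ≤-total; m≤n⇒m⊓n≡m; m≤n⇒m⊔n≡n; m≥n⇒m⊓n≡n; m≥n⇒m⊔n≡m)
open import Data.Product using (_×_; _,_; proj₁; proj₂; ∃)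
open import Data.Sum using (_⊎_; inj₁; inj₂)
open import Data.Vec using (lookup)
open import Function using (_∘_)
open import Function.Bundles using (mk⇔)
open import Relation.Nullary using (¬_; Dec; yes; no)
open import Relation.Nullary.Reflects using (Reflects; ofʸ; ofⁿ)
open import Relation.Binary.PropositionalEquality
  using (_≡_; _≢_; refl; sym; trans; cong; cong₂; subst; ≢-sym; module ≡-Reasoning)

open CommutativeMonoid (CommutativeRing.+-commutativeMonoid xor-∧-commutativeRing)
  using (commutativeSemigroup)
open import Algebra.Properties.CommutativeSemigroup commutativeSemigroup
  using (interchange; x∙yz≈y∙xz)

open ≡-Reasoning

parity : {A : Set} → (A → Bool) → List A → Bool
parity f []       = false
parity f (a ∷ as) = f a xor parity f as

module _ {A : Set} where

  parity-cong : ∀ {f g : A → Bool} (L : List A) →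
                (∀ {a} → a ∈ L → f a ≡ g a) → parity f L ≡ parity g L
  parity-cong []      f≡g = refl
  parity-cong (a ∷ L) f≡g = cong₂ _xor_ (f≡g (here refl)) (parity-cong L (f≡g ∘ there))

  parity-false : ∀ (L : List A) → parity (λ _ → false) L ≡ false
  parity-false []      = refl
  parity-false (a ∷ L) = parity-false L

  parity-xor : ∀ (f g : A → Bool) L →
               parity (λ a → f a xor g a) L ≡ parity f L xor parity g L
  parity-xor f g []      = refl
  parity-xor f g (a ∷ L) =
    trans (cong ((f a xor g a) xor_) (parity-xor f g L)) (interchange (f a) (g a) _ _)

  parity-filter : ∀ (f h : A → Bool) L →
                  parity f (filter (λ a → h a ≟ true) L) ≡ parity (λ a → h a ∧ f a) L
  parity-filter f h []      = refl
  parity-filter f h (a ∷ L) with h a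
  ... | true  = cong (f a xor_) (parity-filter f h L)
  ... | false = parity-filter f h L

  parity-↭ : ∀ (f : A → Bool) {xs ys} → xs ↭ ys → parity f xs ≡ parity f ys
  parity-↭ f ↭-refl           = refl
  parity-↭ f (prep a p)       = cong (f a xor_) (parity-↭ f p)
  parity-↭ f (swap a b p)     =
    trans (cong (λ t → f a xor (f b xor t)) (parity-↭ f p)) (x∙yz≈y∙xz (f a) (f b) _)
  parity-↭ f (↭-trans p₁ p₂) = trans (parity-↭ f p₁) (parity-↭ f p₂)

xor-⊓-⊔ : ∀ (f : ℕ → Bool) a b → f (a ⊓ b) xor f (a ⊔ b) ≡ f a xor f b
xor-⊓-⊔ f a b with ≤-total a b
... | inj₁ a≤b rewrite m≤n⇒m⊓n≡m a≤b | m≤n⇒m⊔n≡n a≤b = refl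
... | inj₂ b≤a rewrite m≥n⇒m⊓n≡n b≤a | m≥n⇒m⊔n≡m b≤a = xor-comm (f b) (f a)

reflects-≡true : ∀ {P : Set} {b} → Reflects P b → (P → b ≡ true) × (b ≡ true → P)
reflects-≡true (ofʸ p)  = (λ _ → refl) , (λ _ → p)
reflects-≡true (ofⁿ ¬p) = (λ p → ⊥-elim (¬p p)) , (λ ())

△-reflects : ∀ {A B : PointSet} {a b} q →
             Reflects (A q) a → Reflects (B q) b → Reflects ((A △ B) q) (a xor b)
△-reflects q (ofʸ p)  (ofʸ p′)  = ofⁿ λ { (inj₁ (_ , ¬p′)) → ¬p′ p′ ; (inj₂ (¬p , _)) → ¬p p }
△-reflects q (ofʸ p)  (ofⁿ ¬p′) = ofʸ (inj₁ (p , ¬p′))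
△-reflects q (ofⁿ ¬p) (ofʸ p′)  = ofʸ (inj₂ (¬p , p′))
△-reflects q (ofⁿ ¬p) (ofⁿ ¬p′) = ofⁿ λ { (inj₁ (p , _)) → ¬p p ; (inj₂ (_ , p′)) → ¬p′ p′ }

hs-parity : ℕ → ℕ × ℕ → Bool
hs-parity a q = (a ≤ᵇ proj₁ q) xor (a ≤ᵇ proj₂ q)

△-family-hs-reflects : ∀ {A : Set} (c : A → ℕ) (L : List A) q →
  Reflects (△-family (concatMap (λ e → hs x (c e) ∷ hs y (c e) ∷ []) L) q)
           (parity (λ e → hs-parity (c e) q) L)
△-family-hs-reflects c []      q = ofⁿ (λ ())
△-family-hs-reflects c (e ∷ L) q =
  subst (Reflects (△-family (hs x (c e) ∷ hs y (c e) ∷ rest) q))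
        (sym (xor-assoc (c e ≤ᵇ proj₁ q) (c e ≤ᵇ proj₂ q) _))
        (△-reflects {A = hs x (c e)} {B = hs y (c e) △ △-family rest} q (≤ᵇ-reflects-≤ (c e) (proj₁ q))
          (△-reflects {A = hs y (c e)} {B = △-family rest} q (≤ᵇ-reflects-≤ (c e) (proj₂ q))
            (△-family-hs-reflects c L q)))
  where
  rest : List PointSet
  rest = concatMap (λ e → hs x (c e) ∷ hs y (c e) ∷ []) L

module _ {n : ℕ} where

  pos-head : ∀ (e : Pair n) L → pos e (e ∷ L) ≡ 1
  pos-head e L with e ≟ₚ e
  ... | yes _  = refl
  ... | no e≢e = ⊥-elim (e≢e refl)

  pos-tail : ∀ {e a : Pair n} L → e ≢ a → pos e (a ∷ L) ≡ suc (pos e L)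
  pos-tail {e} {a} L e≢a with e ≟ₚ a
  ... | yes e≡a = ⊥-elim (e≢a e≡a)
  ... | no  _   = refl

  take-pos : ∀ {e : Pair n} {L} → e ∈ L → ∃ λ P → take (pos e L) L ≡ P ++ [ e ]
  take-pos {e} {a ∷ L} e∈ with e ≟ₚ a | e∈
  ... | yes refl | _         = [] , refl
  ... | no  e≢a  | here e≡a  = ⊥-elim (e≢a e≡a)
  ... | no  _    | there e∈L with take-pos e∈L
  ...   | P , eq = a ∷ P , cong (a ∷_) eq

  suc≤ᵇ0 : ∀ m → (suc m ≤ᵇ 0) ≡ false
  suc≤ᵇ0 zero    = refl
  suc≤ᵇ0 (suc m) = refl

  suc≤ᵇsuc : ∀ m k → (suc m ≤ᵇ suc k) ≡ (m ≤ᵇ k)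
  suc≤ᵇsuc zero    k = refl
  suc≤ᵇsuc (suc m) k = refl

  -- Uniqueness is needed because pos finds only the first occurrence.
  parity-pos≤ᵇ : ∀ (h : Pair n → Bool) L → Unique L → ∀ k →
                 parity (λ e → h e ∧ (pos e L ≤ᵇ k)) L ≡ parity h (take k L)
  parity-pos≤ᵇ h []      _            zero    = refl
  parity-pos≤ᵇ h []      _            (suc k) = refl
  parity-pos≤ᵇ h (e ∷ L) (e≢L ∷ uniq) zero    = begin
    (h e ∧ (pos e (e ∷ L) ≤ᵇ 0)) xor parity (λ e′ → h e′ ∧ (pos e′ (e ∷ L) ≤ᵇ 0)) L
      ≡⟨ cong₂ _xor_ (cong (λ m → h e ∧ (m ≤ᵇ 0)) (pos-head e L))
                     (parity-cong L (λ {e′} e′∈L → trans (cong (λ m → h e′ ∧ (m ≤ᵇ 0)) (shift e′∈L))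
                                          (trans (cong (h e′ ∧_) (suc≤ᵇ0 (pos e′ L))) (∧-zeroʳ (h e′))))) ⟩
    (h e ∧ false) xor parity (λ _ → false) L
      ≡⟨ cong₂ _xor_ (∧-zeroʳ (h e)) (parity-false L) ⟩
    false ∎
    where
    shift : ∀ {e′} → e′ ∈ L → pos e′ (e ∷ L) ≡ suc (pos e′ L)
    shift e′∈L = pos-tail L (≢-sym (All.lookup e≢L e′∈L))
  parity-pos≤ᵇ h (e ∷ L) (e≢L ∷ uniq) (suc k) = begin
    (h e ∧ (pos e (e ∷ L) ≤ᵇ suc k)) xor parity (λ e′ → h e′ ∧ (pos e′ (e ∷ L) ≤ᵇ suc k)) L
      ≡⟨ cong₂ _xor_ (cong (λ m → h e ∧ (m ≤ᵇ suc k)) (pos-head e L))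
                     (parity-cong L (λ {e′} e′∈L → cong (h e′ ∧_) (trans (cong (_≤ᵇ suc k) (shift e′∈L))
                                                                (suc≤ᵇsuc (pos e′ L) k)))) ⟩
    (h e ∧ true) xor parity (λ e′ → h e′ ∧ (pos e′ L ≤ᵇ k)) L
      ≡⟨ cong₂ _xor_ (∧-identityʳ (h e)) (parity-pos≤ᵇ h L uniq k) ⟩
    h e xor parity h (take k L) ∎
    where
    shift : ∀ {e′} → e′ ∈ L → pos e′ (e ∷ L) ≡ suc (pos e′ L)
    shift e′∈L = pos-tail L (≢-sym (All.lookup e≢L e′∈L))

module _ {n : ℕ} where

  Chain-take : ∀ {a b : Fin n} L → Chain a L b → ∀ k → ∃ λ m → Chain a (take k L) m
  Chain-take L             walk zero    = _ , refl
  Chain-take []            walk (suc k) = _ , refl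
  Chain-take ((u , v) ∷ L) (a≡u , walk) (suc k) with Chain-take L walk k
  ... | m , walk′ = m , a≡u , walk′

  Chain-snoc⁻ : ∀ {a b u v : Fin n} P → Chain a (P ++ [ (u , v) ]) b → v ≡ b
  Chain-snoc⁻ []            (_ , v≡b) = v≡b
  Chain-snoc⁻ ((_ , _) ∷ P) (_ , walk) = Chain-snoc⁻ P walk

  Chain-parity : ∀ (S : Subset n) {a b} L → Chain a L b →
                 parity (crosses S) L ≡ lookup S a xor lookup S b
  Chain-parity S {a} []            refl          = sym (xor-same (lookup S a))
  Chain-parity S {a} {b} ((u , v) ∷ L) (refl , walk) = begin
    (lookup S a xor lookup S v) xor parity (crosses S) L
      ≡⟨ cong ((lookup S a xor lookup S v) xor_) (Chain-parity S L walk) ⟩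
    (lookup S a xor lookup S v) xor (lookup S v xor lookup S b)
      ≡⟨ cancel (lookup S a) (lookup S v) (lookup S b) ⟩
    lookup S a xor lookup S b ∎
    where
    cancel : ∀ p q s → (p xor q) xor (q xor s) ≡ p xor s
    cancel p q s = begin
      (p xor q) xor (q xor s)  ≡⟨ xor-assoc p q (q xor s) ⟩
      p xor (q xor (q xor s))  ≡⟨ cong (p xor_) (sym (xor-assoc q q s)) ⟩
      p xor ((q xor q) xor s)  ≡⟨ cong (λ t → p xor (t xor s)) (xor-same q) ⟩
      p xor s                  ∎

module _ {n : ℕ} {G : Graph n} {r : Fin n} (T : RootedSpanningTree G r) where

  -- Iterating the parent map from v stays inside {v , w}, so never reaches r.
  parent-acyclic₂ : ∀ {v w} → v ≢ r → w ≢ r → parent T v ≡ w → parent T w ≡ v → ⊥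
  parent-acyclic₂ {v} {w} v≢r w≢r pv≡w pw≡v with reaches T v
  ... | k , vₖ≡r with alternates k
    where
    alternates : ∀ k → (iter (parent T) k v ≡ v) ⊎ (iter (parent T) k v ≡ w)
    alternates zero    = inj₁ refl
    alternates (suc k) with alternates k
    ... | inj₁ vₖ≡v = inj₂ (trans (cong (parent T) vₖ≡v) pv≡w)
    ... | inj₂ vₖ≡w = inj₁ (trans (cong (parent T) vₖ≡w) pw≡v)
  ... | inj₁ vₖ≡v = v≢r (trans (sym vₖ≡v) vₖ≡r)
  ... | inj₂ vₖ≡w = w≢r (trans (sym vₖ≡w) vₖ≡r)

  childArcs : Fin n → List (Pair n)
  childArcs v with v ≟ᶠ r
  ... | yes _ = []
  ... | no  _ = (parent T v , v) ∷ (v , parent T v) ∷ []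

  -- The underscore is the local arcsAt of treeArcs, which cannot be named;
  -- the mutual block lets the first declaration solve it.
  mutual
    treeArcs≡ : treeArcs T ≡ concatMap childArcs (allFin n)
    treeArcs≡ = concatMap-cong arcsAt≗childArcs (allFin n)

    arcsAt≗childArcs : ∀ v → _ ≡ childArcs v
    arcsAt≗childArcs v with v ≟ᶠ r
    ... | yes _ = refl
    ... | no  _ = refl

  childArcs-unique : ∀ v → Unique (childArcs v)
  childArcs-unique v with v ≟ᶠ r
  ... | yes _   = []
  ... | no  v≢r = ((λ eq → parent-acyclic₂ v≢r v≢r (cong proj₁ eq) (cong proj₁ eq)) ∷ []) ∷ [] ∷ []

  childArcs-disjoint : ∀ {v w} → v ≢ w → Disjoint (childArcs v) (childArcs w)
  childArcs-disjoint {v} {w} v≢w (e∈v , e∈w) with v ≟ᶠ r | w ≟ᶠ r | e∈v | e∈w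
  ... | yes _ | _     | () | _
  ... | no _  | yes _ | _  | ()
  ... | no _   | no _   | here refl       | here eq         = v≢w (cong proj₂ eq)
  ... | no v≢r | no w≢r | here refl       | there (here eq) =
    parent-acyclic₂ v≢r w≢r (cong proj₁ eq) (sym (cong proj₂ eq))
  ... | no v≢r | no w≢r | there (here refl) | here eq       =
    parent-acyclic₂ v≢r w≢r (cong proj₂ eq) (sym (cong proj₁ eq))
  ... | no _   | no _   | there (here refl) | there (here eq) = v≢w (cong proj₁ eq)

  childArcs⇒IsArc : ∀ {e} v → e ∈ childArcs v → IsArc T e
  childArcs⇒IsArc v e∈ with v ≟ᶠ r | e∈
  ... | no v≢r | here refl         = inj₁ (v≢r , refl)
  ... | no v≢r | there (here refl) = inj₂ (v≢r , refl)

  IsArc⇒childArcs : ∀ {e} → IsArc T e → ∃ λ v → e ∈ childArcs v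
  IsArc⇒childArcs {u , v} (inj₁ (v≢r , refl)) = v , down
    where
    down : (parent T v , v) ∈ childArcs v
    down with v ≟ᶠ r
    ... | yes v≡r = ⊥-elim (v≢r v≡r)
    ... | no  _   = here refl
  IsArc⇒childArcs {u , v} (inj₂ (u≢r , refl)) = u , up
    where
    up : (u , parent T u) ∈ childArcs u
    up with u ≟ᶠ r
    ... | yes u≡r = ⊥-elim (u≢r u≡r)
    ... | no  _   = there (here refl)

  treeArcs-unique : Unique (treeArcs T)
  treeArcs-unique = subst Unique (sym treeArcs≡)
    (concat⁺ (All-map⁺ (All.tabulate (λ {v} _ → childArcs-unique v)))
             (AllPairs-map⁺ (AllPairs.map childArcs-disjoint (allFin⁺ n))))

  ∈-treeArcs⇔IsArc : ∀ {e} → (e ∈ treeArcs T → IsArc T e) × (IsArc T e → e ∈ treeArcs T)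
  ∈-treeArcs⇔IsArc {e} = to , from
    where
    to : e ∈ treeArcs T → IsArc T e
    to e∈ with satisfied (∈-concatMap⁻ childArcs {xs = allFin n} (subst (e ∈_) treeArcs≡ e∈))
    ... | v , e∈v = childArcs⇒IsArc v e∈v
    from : IsArc T e → e ∈ treeArcs T
    from arc with IsArc⇒childArcs arc
    ... | v , e∈v = subst (e ∈_) (sym treeArcs≡) (∈-concatMap⁺ childArcs (lose (∈-allFin v) e∈v))

  tour↭treeArcs : ∀ {tour} → IsEulerTour T tour → tour ↭ treeArcs T
  tour↭treeArcs euler = ∼bag⇒↭ (unique∧set⇒bag (noRepeat euler) treeArcs-unique
    (mk⇔ (λ e∈ → proj₂ ∈-treeArcs⇔IsArc (All.lookup (onlyArcs euler) e∈))
         (λ e∈ → allArcs euler _ (proj₁ ∈-treeArcs⇔IsArc e∈))))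

module _ {n : ℕ} {G : Graph n} {r : Fin n} {T : RootedSpanningTree G r}
         {tour : List (Pair n)} (euler : IsEulerTour T tour) (S : Subset n) where

  open Coords T tour

  prefixParity : ℕ → Bool
  prefixParity k = parity (crosses S) (take k tour)

  -- The first c(u) arcs of the tour are a walk from r ending with parent(u) → u.
  prefixParity-cV : ∀ u → prefixParity (cV u) ≡ lookup S r xor lookup S u
  prefixParity-cV u with u ≟ᶠ r
  ... | yes refl = sym (xor-same (lookup S u))
  ... | no  u≢r with take-pos (allArcs euler (parent T u , u) (inj₁ (u≢r , refl)))
  ...   | P , prefix≡ with Chain-take tour (closed euler) (cArc (parent T u , u))
  ...     | m , walk = begin
    parity (crosses S) (take (cArc (parent T u , u)) tour)  ≡⟨ Chain-parity S _ walk ⟩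
    lookup S r xor lookup S m                              ≡⟨ cong (λ w → lookup S r xor lookup S w) m≡u ⟩
    lookup S r xor lookup S u                              ∎
    where
    m≡u : m ≡ u
    m≡u = sym (Chain-snoc⁻ P (subst (λ L → Chain r L m) prefix≡ walk))

  boundaryParity : ∀ q → parity (λ e → hs-parity (cArc e) q) (∂T⃗ T S)
                       ≡ prefixParity (proj₁ q) xor prefixParity (proj₂ q)
  boundaryParity q = begin
    parity (hsAt q) (filter crosses? (treeArcs T))
      ≡⟨ parity-↭ (hsAt q) (filter-↭ crosses? (↭-sym (tour↭treeArcs T euler))) ⟩
    parity (hsAt q) (filter crosses? tour)
      ≡⟨ parity-filter (hsAt q) (crosses S) tour ⟩
    parity (λ e → crosses S e ∧ hsAt q e) tour
      ≡⟨ parity-cong tour (λ {e} _ → ∧-distribˡ-xor (crosses S e) _ _) ⟩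
    parity (λ e → (crosses S e ∧ (cArc e ≤ᵇ proj₁ q)) xor (crosses S e ∧ (cArc e ≤ᵇ proj₂ q))) tour
      ≡⟨ parity-xor _ _ tour ⟩
    parity (λ e → crosses S e ∧ (cArc e ≤ᵇ proj₁ q)) tour
      xor parity (λ e → crosses S e ∧ (cArc e ≤ᵇ proj₂ q)) tour
      ≡⟨ cong₂ _xor_ (parity-pos≤ᵇ (crosses S) tour (noRepeat euler) (proj₁ q))
                     (parity-pos≤ᵇ (crosses S) tour (noRepeat euler) (proj₂ q)) ⟩
    prefixParity (proj₁ q) xor prefixParity (proj₂ q) ∎
    where
    hsAt : ℕ × ℕ → Pair n → Bool
    hsAt q′ e = hs-parity (cArc e) q′
    crosses? : (e : Pair n) → Dec (crosses S e ≡ true)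
    crosses? e = crosses S e ≟ true

  boundaryParity-at-p : ∀ u v → parity (λ e → hs-parity (cArc e) (p (u , v))) (∂T⃗ T S)
                           ≡ crosses S (u , v)
  boundaryParity-at-p u v = begin
    parity (λ e → hs-parity (cArc e) (p (u , v))) (∂T⃗ T S)
      ≡⟨ boundaryParity (p (u , v)) ⟩
    prefixParity (cV u ⊓ cV v) xor prefixParity (cV u ⊔ cV v)
      ≡⟨ xor-⊓-⊔ prefixParity (cV u) (cV v) ⟩
    prefixParity (cV u) xor prefixParity (cV v)
      ≡⟨ cong₂ _xor_ (prefixParity-cV u) (prefixParity-cV v) ⟩
    (lookup S r xor lookup S u) xor (lookup S r xor lookup S v)
      ≡⟨ interchange (lookup S r) (lookup S u) (lookup S r) (lookup S v) ⟩
    (lookup S r xor lookup S r) xor (lookup S u xor lookup S v)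
      ≡⟨ cong (_xor (lookup S u xor lookup S v)) (xor-same (lookup S r)) ⟩
    crosses S (u , v) ∎

  ∈boundarySymDiff⇔crosses : ∀ e → (boundarySymDiff T tour S (p e) → crosses S e ≡ true)
                                 × (crosses S e ≡ true → boundarySymDiff T tour S (p e))
  ∈boundarySymDiff⇔crosses (u , v) =
    reflects-≡true (subst (Reflects (boundarySymDiff T tour S (p (u , v))))
                          (boundaryParity-at-p u v)
                          (△-family-hs-reflects cArc (∂T⃗ T S) (p (u , v))))

lemma3 : {n : ℕ} (G : Graph n) (r : Fin n) (T : RootedSpanningTree G r)
         (tour : List (Pair n)) → IsEulerTour T tour →
         (S : Subset n) (E' : Pair n → Set) →
         (∀ e → E' e → Adj G (proj₁ e) (proj₂ e) × ¬ TreeEdge T e) →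
         ∀ e → (∂E E' S e → E' e × boundarySymDiff T tour S (Coords.p T tour e))
             × (E' e × boundarySymDiff T tour S (Coords.p T tour e) → ∂E E' S e)
lemma3 G r T tour euler S E' _ e =
  (λ (e∈E' , crossing) → e∈E' , proj₂ (∈boundarySymDiff⇔crosses euler S e) crossing) ,
  (λ (e∈E' , e∈△) → e∈E' , proj₁ (∈boundarySymDiff⇔crosses euler S e) e∈△)
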